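{- Let $m\geqslant 3$ and $n\geqslant 3$ be odd integers, $m=2m_0+1$, $n=2n_0+1$. Let $X=\{x_{i,j}\}$ be a bicentrally balanced $C_4$-face-magic projective labeling on $\mathcal{P}_{m,n}$ with $C_4$-face-magic value $S$. For $1\leqslant j\leqslant n_0$ let $a_j=x_{1,j}+x_{1,j+1}$. Then: (1) for all odd $i$ with $1\leqslant i\leqslant m_0$ and all $1\leqslant j\leqslant n_0$, $x_{i,j}+x_{i,j+1}=a_j$, $x_{i,n+1-j}+x_{i,n-j}=S-a_j$, $x_{m+1-i,j}+x_{m+1-i,j+1}=a_j$, and $x_{m+1-i,n+1-j}+x_{m+1-i,n-j}=S-a_j$; (2) for all even $i$ with $1\leqslant i\leqslant m_0$ and all $1\leqslant j\leqslant n_0$, $x_{i,j}+x_{i,j+1}=S-a_j$, $x_{i,n+1-j}+x_{i,n-j}=a_j$, $x_{m+1-i,j}+x_{m+1-i,j+1}=S-a_j$, and $x_{m+1-i,n+1-j}+x_{m+1-i,n-j}=a_j$.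
   Context: For integers $m,n\geqslant 2$, the projective grid graph $\mathcal{P}_{m,n}$ has vertex set $\{(i,j):1\leqslant i\leqslant m,\ 1\leqslant j\leqslant n\}$ and edges $(i,j)$–$(i,j+1)$ ($j\leqslant n-1$), $(i,n)$–$(m+1-i,1)$, $(i,j)$–$(i+1,j)$ ($i\leqslant m-1$), $(m,j)$–$(1,n+1-j)$, embedded naturally in the projective plane. Its 4-cycle faces are $\{(i,j),(i+1,j),(i,j+1),(i+1,j+1)\}$ ($1\leqslant i\leqslant m-1$, $1\leqslant j\leqslant n-1$), $\{(i,n),(i+1,n),(m+1-i,1),(m-i,1)\}$ ($1\leqslant i\leqslant m-1$), and $\{(m,j),(m,j+1),(1,n+1-j),(1,n-j)\}$ ($1\leqslant j\leqslant n-1$); the other two faces are digons $\{(1,1),(m,n)\}$, $\{(m,1),(1,n)\}$. A $C_4$-face-magic projective labeling is a bijection $(i,j)\mapsto x_{i,j}$ onto $\{1,\ldots,mn\}$ such that every 4-cycle face has the same label sum $S$ (the $C_4$-face-magic value). For odd $m,n$ let $S(i,j)=\tfrac12 mn+\tfrac32$ if $i+j$ is even and $S(i,j)=\tfrac32 mn+\tfrac32$ if $i+j$ is odd; a $C_4$-face-magic projective labeling with value $2mn+3$ is bicentrally balanced if $x_{i,j}+x_{m+1-i,n+1-j}=S(i,j)$ for all $(i,j)$. -}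

module Defs where

open import Data.Nat using (ℕ; _+_; _*_; _∸_; _≤_; _/_; _%_)
open import Data.Product using (_×_; ∃₂)
open import Relation.Binary.PropositionalEquality using (_≡_)

-- A labeling of the vertices (i , j), 1 ≤ i ≤ m, 1 ≤ j ≤ n, of P_{m,n}
-- is represented as a function x : ℕ → ℕ → ℕ with x i j = x_{i,j};
-- values outside the index range are irrelevant.

InGrid : ℕ → ℕ → ℕ → ℕ → Set
InGrid m n i j = (1 ≤ i × i ≤ m) × (1 ≤ j × j ≤ n)

IsBijectiveLabeling : ℕ → ℕ → (ℕ → ℕ → ℕ) → Set
IsBijectiveLabeling m n x =
  (∀ i j → InGrid m n i j → 1 ≤ x i j × x i j ≤ m * n)
  × (∀ i j i' j' → InGrid m n i j → InGrid m n i' j' →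
       x i j ≡ x i' j' → (i ≡ i' × j ≡ j'))
  × (∀ k → 1 ≤ k → k ≤ m * n → ∃₂ λ i j → InGrid m n i j × x i j ≡ k)

IsFaceMagic : ℕ → ℕ → (ℕ → ℕ → ℕ) → ℕ → Set
IsFaceMagic m n x S =
  (∀ i j → 1 ≤ i → i ≤ m ∸ 1 → 1 ≤ j → j ≤ n ∸ 1 →
     x i j + x (i + 1) j + x i (j + 1) + x (i + 1) (j + 1) ≡ S)
  × (∀ i → 1 ≤ i → i ≤ m ∸ 1 →
     x i n + x (i + 1) n + x (m + 1 ∸ i) 1 + x (m ∸ i) 1 ≡ S)
  × (∀ j → 1 ≤ j → j ≤ n ∸ 1 →
     x m j + x m (j + 1) + x 1 (n + 1 ∸ j) + x 1 (n ∸ j) ≡ S)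

IsC4FaceMagicProjLabeling : ℕ → ℕ → (ℕ → ℕ → ℕ) → ℕ → Set
IsC4FaceMagicProjLabeling m n x S = IsBijectiveLabeling m n x × IsFaceMagic m n x S

-- S(i,j) for odd m, n: (mn+3)/2 if i+j even, (3mn+3)/2 if i+j odd
-- (exact divisions since mn is odd).
BalanceValue : ℕ → ℕ → ℕ → ℕ → ℕ → Set
BalanceValue m n i j s =
  ((i + j) % 2 ≡ 0 → s ≡ (m * n + 3) / 2) × ((i + j) % 2 ≡ 1 → s ≡ (3 * m * n + 3) / 2)

IsBicentrallyBalanced : ℕ → ℕ → (ℕ → ℕ → ℕ) → Set
IsBicentrallyBalanced m n x =
  IsC4FaceMagicProjLabeling m n x (2 * m * n + 3)
  × (∀ i j → InGrid m n i j →
       BalanceValue m n i j (x i j + x (m + 1 ∸ i) (n + 1 ∸ j)))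

-- Reading each interior 4-face as two horizontal pairs shows that the pair sums
-- r(i, j) = x(i, j) + x(i, j+1) satisfy r(i, j) + r(i+1, j) = S, so along every
-- column r alternates between r(1, j) = a_j on odd rows and S - a_j on even rows;
-- since m is odd, rows i and m+1-i have the same parity.  The reflected sums come
-- from bicentral balance: a_j + r(m, n-j) is the sum of the two balance values at
-- (1, j) and (1, j+1), one of each parity, i.e. (mn+3)/2 + (3mn+3)/2 = 2mn+3 = S,
-- and r(m, n-j) = r(1, n-j) because m is odd.
module Submission where

open import Defs
open import Data.Nat using (ℕ; zero; suc; _+_; _*_; _∸_; _≤_; _<_; _%_; _/_; s≤s; z≤n)
open import Data.Nat.Properties
open import Data.Nat.DivMod using (m*n/n≡m; m%n<n; %-distribˡ-+)
open import Data.Nat.Solver using (module +-*-Solver)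
open import Data.Product using (∃; _×_; _,_; proj₁; proj₂)
open import Data.Sum using (_⊎_; inj₁; inj₂)
open import Relation.Binary.PropositionalEquality
open +-*-Solver

+1≤⇒≤∸1 : ∀ {i m} → i + 1 ≤ m → i ≤ m ∸ 1
+1≤⇒≤∸1 {i} {m} h = subst (_≤ m ∸ 1) (m+n∸n≡m i 1) (∸-monoˡ-≤ 1 h)

parity-step : ∀ t → (t % 2 ≡ 0 × (t + 1) % 2 ≡ 1) ⊎ (t % 2 ≡ 1 × (t + 1) % 2 ≡ 0)
parity-step t with t % 2 | m%n<n t 2 | %-distribˡ-+ t 1 2
... | 0 | _ | [t+1]%2 = inj₁ (refl , [t+1]%2)
... | 1 | _ | [t+1]%2 = inj₂ (refl , [t+1]%2)
... | suc (suc _) | s≤s (s≤s ()) | _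

mirror-index : ∀ {m₀ i} → 1 ≤ i → i ≤ m₀ →
  ∃ λ d → (2 * m₀ + 1) + 1 ∸ i ≡ i + 2 * d × i + 2 * d ≤ 2 * m₀ + 1
mirror-index {i = suc i} _ i≤m₀ with m≤n⇒∃[o]m+o≡n i≤m₀
... | e , refl = e + 1 , distance , bound
  where
    distance : 2 * (suc i + e) + 1 + 1 ∸ suc i ≡ suc i + 2 * (e + 1)
    distance = trans
      (cong (_∸ suc i) (solve 2 (λ i e → con 2 :* (con 1 :+ i :+ e) :+ con 1 :+ con 1
                                      := (con 1 :+ i) :+ ((con 1 :+ i) :+ con 2 :* (e :+ con 1))) refl i e))
      (m+n∸m≡n (suc i) _)
    bound : suc i + 2 * (e + 1) ≤ 2 * (suc i + e) + 1
    bound = subst (suc i + 2 * (e + 1) ≤_)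
      (solve 2 (λ i e → (con 1 :+ i) :+ con 2 :* (e :+ con 1) :+ i
                     := con 2 :* (con 1 :+ i :+ e) :+ con 1) refl i e)
      (m≤m+n _ i)

module ConstantConsecutiveSums (f : ℕ → ℕ) {S m : ℕ}
         (consecutive : ∀ i → 1 ≤ i → i + 1 ≤ m → f i + f (i + 1) ≡ S) where

  f≡f[+2] : ∀ i → 1 ≤ i → i + 2 ≤ m → f i ≡ f (i + 2)
  f≡f[+2] i 1≤i i+2≤m = +-cancelʳ-≡ (f (i + 1)) (f i) (f (i + 2)) (begin
      f i + f (i + 1)           ≡⟨ consecutive i 1≤i (≤-trans (+-monoʳ-≤ i (s≤s z≤n)) i+2≤m) ⟩
      S                         ≡⟨ consecutive (i + 1) (≤-trans 1≤i (m≤m+n i 1))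
                                     (≤-trans (≤-reflexive (+-assoc i 1 1)) i+2≤m) ⟨
      f (i + 1) + f (i + 1 + 1) ≡⟨ cong (λ k → f (i + 1) + f k) (+-assoc i 1 1) ⟩
      f (i + 1) + f (i + 2)     ≡⟨ +-comm (f (i + 1)) (f (i + 2)) ⟩
      f (i + 2) + f (i + 1)     ∎)
    where open ≡-Reasoning

  f≡f[+2*d] : ∀ d i → 1 ≤ i → i + 2 * d ≤ m → f i ≡ f (i + 2 * d)
  f≡f[+2*d] zero    i _   _ = cong f (sym (+-identityʳ i))
  f≡f[+2*d] (suc d) i 1≤i h = begin
      f i               ≡⟨ f≡f[+2] i 1≤i (≤-trans (+-monoʳ-≤ i (*-monoʳ-≤ 2 (s≤s z≤n))) h) ⟩
      f (i + 2)         ≡⟨ f≡f[+2*d] d (i + 2) (≤-trans 1≤i (m≤m+n i 2)) (subst (_≤ m) (sym shift) h) ⟩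
      f (i + 2 + 2 * d) ≡⟨ cong f shift ⟩
      f (i + 2 * suc d) ∎
    where
      open ≡-Reasoning
      shift : i + 2 + 2 * d ≡ i + 2 * suc d
      shift = trans (+-assoc i 2 (2 * d)) (cong (i +_) (sym (*-suc 2 d)))

  f[odd]≡f[1] : ∀ k → 2 * k + 1 ≤ m → f (2 * k + 1) ≡ f 1
  f[odd]≡f[1] k h = sym (trans (f≡f[+2*d] k 1 ≤-refl (subst (_≤ m) 2k+1≡1+2k h))
                               (cong f (sym 2k+1≡1+2k)))
    where
      2k+1≡1+2k : 2 * k + 1 ≡ 1 + 2 * k
      2k+1≡1+2k = +-comm (2 * k) 1

  f[even]+f[1]≡S : ∀ k → 2 * k + 2 ≤ m → f (2 * k + 2) + f 1 ≡ S
  f[even]+f[1]≡S k h = begin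
      f (2 * k + 2) + f 1 ≡⟨ cong (λ i → f i + f 1) (+-comm (2 * k) 2) ⟩
      f (2 + 2 * k) + f 1 ≡⟨ cong (_+ f 1) (f≡f[+2*d] k 2 (s≤s z≤n) (subst (_≤ m) (+-comm (2 * k) 2) h)) ⟨
      f 2 + f 1           ≡⟨ +-comm (f 2) (f 1) ⟩
      f 1 + f 2           ≡⟨ consecutive 1 ≤-refl (≤-trans (m≤n+m 2 (2 * k)) h) ⟩
      S                   ∎
    where open ≡-Reasoning

  f[mirror]≡f : ∀ {m₀} → m ≡ 2 * m₀ + 1 → ∀ i → 1 ≤ i → i ≤ m₀ → f (m + 1 ∸ i) ≡ f i
  f[mirror]≡f refl i 1≤i i≤m₀ with mirror-index 1≤i i≤m₀
  ... | d , m+1∸i≡i+2d , i+2d≤m = trans (cong f m+1∸i≡i+2d) (sym (f≡f[+2*d] d i 1≤i i+2d≤m))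

rowSum : (ℕ → ℕ → ℕ) → ℕ → ℕ → ℕ
rowSum x i j = x i j + x i (j + 1)

module _ {m n : ℕ} {x : ℕ → ℕ → ℕ} {S : ℕ} (magic : IsFaceMagic m n x S) where

  rowSum-consecutive : ∀ {j} → 1 ≤ j → j + 1 ≤ n →
    ∀ i → 1 ≤ i → i + 1 ≤ m → rowSum x i j + rowSum x (i + 1) j ≡ S
  rowSum-consecutive {j} 1≤j j+1≤n i 1≤i i+1≤m = trans
    (solve 4 (λ p q u v → (p :+ u) :+ (q :+ v) := p :+ q :+ u :+ v) refl
       (x i j) (x (i + 1) j) (x i (j + 1)) (x (i + 1) (j + 1)))
    (proj₁ magic i j 1≤i (+1≤⇒≤∸1 i+1≤m) 1≤j (+1≤⇒≤∸1 j+1≤n))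

  faceMagic-value-unique : ∀ {S′} → 2 ≤ m → 2 ≤ n → IsFaceMagic m n x S′ → S ≡ S′
  faceMagic-value-unique 2≤m 2≤n magic′ = trans (sym (face magic)) (face magic′)
    where
      face : ∀ {T} → IsFaceMagic m n x T → x 1 1 + x 2 1 + x 1 2 + x 2 2 ≡ T
      face magicT = proj₁ magicT 1 1 ≤-refl (+1≤⇒≤∸1 2≤m) ≤-refl (+1≤⇒≤∸1 2≤n)

balanceValue-pair-sum : ∀ m n i j {s s′} →
  BalanceValue m n i j s → BalanceValue m n i (j + 1) s′ →
  s + s′ ≡ (m * n + 3) / 2 + (3 * m * n + 3) / 2
balanceValue-pair-sum m n i j (even , odd) (even′ , odd′)
  with parity-step (i + j)
... | inj₁ (p , p′) = cong₂ _+_ (even p) (odd′ (trans (cong (_% 2) (sym (+-assoc i j 1))) p′))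
... | inj₂ (p , p′) = trans (cong₂ _+_ (odd p) (even′ (trans (cong (_% 2) (sym (+-assoc i j 1))) p′)))
                            (+-comm ((3 * m * n + 3) / 2) ((m * n + 3) / 2))

balanceValues-odd : ∀ {p} q → p ≡ 2 * q + 1 → (p + 3) / 2 + (3 * p + 3) / 2 ≡ 2 * p + 3
balanceValues-odd q refl = begin
    (2 * q + 1 + 3) / 2 + (3 * (2 * q + 1) + 3) / 2
      ≡⟨ cong₂ (λ u v → u / 2 + v / 2)
           (solve 1 (λ q → con 2 :* q :+ con 1 :+ con 3 := (q :+ con 2) :* con 2) refl q)
           (solve 1 (λ q → con 3 :* (con 2 :* q :+ con 1) :+ con 3 := (con 3 :* q :+ con 3) :* con 2) refl q) ⟩
    (q + 2) * 2 / 2 + (3 * q + 3) * 2 / 2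
      ≡⟨ cong₂ _+_ (m*n/n≡m (q + 2) 2) (m*n/n≡m (3 * q + 3) 2) ⟩
    q + 2 + (3 * q + 3)
      ≡⟨ solve 1 (λ q → q :+ con 2 :+ (con 3 :* q :+ con 3) := con 2 :* (con 2 :* q :+ con 1) :+ con 3) refl q ⟩
    2 * (2 * q + 1) + 3 ∎
  where open ≡-Reasoning

balanceValues-sum : ∀ m₀ n₀ → let m = 2 * m₀ + 1 ; n = 2 * n₀ + 1 in
  (m * n + 3) / 2 + (3 * m * n + 3) / 2 ≡ 2 * m * n + 3
balanceValues-sum m₀ n₀ = begin
    (m * n + 3) / 2 + (3 * m * n + 3) / 2   ≡⟨ cong (λ t → (m * n + 3) / 2 + (t + 3) / 2) (*-assoc 3 m n) ⟩
    (m * n + 3) / 2 + (3 * (m * n) + 3) / 2 ≡⟨ balanceValues-odd (2 * m₀ * n₀ + m₀ + n₀) odd*odd ⟩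
    2 * (m * n) + 3                         ≡⟨ cong (_+ 3) (*-assoc 2 m n) ⟨
    2 * m * n + 3                           ∎
  where
    open ≡-Reasoning
    m = 2 * m₀ + 1
    n = 2 * n₀ + 1
    odd*odd : m * n ≡ 2 * (2 * m₀ * n₀ + m₀ + n₀) + 1
    odd*odd = solve 2 (λ a b → (con 2 :* a :+ con 1) :* (con 2 :* b :+ con 1)
                            := con 2 :* (con 2 :* a :* b :+ a :+ b) :+ con 1) refl m₀ n₀

mirror-column : ∀ {n j} → 1 ≤ j → j + 1 ≤ n → 1 ≤ n ∸ j × n ∸ j + 1 ≤ n
mirror-column {n} {j} 1≤j j+1≤n =
  m<n⇒0<n∸m j<n ,
  subst (_≤ n) (+-∸-comm 1 (<⇒≤ j<n)) (subst (n + 1 ∸ j ≤_) (m+n∸n≡m n 1) (∸-monoʳ-≤ (n + 1) 1≤j))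
  where
    j<n : j < n
    j<n = subst (_≤ n) (+-comm j 1) j+1≤n

mirrored-pair≡rowSum : ∀ (x : ℕ → ℕ → ℕ) i {n j} → j ≤ n →
  x i (n + 1 ∸ j) + x i (n ∸ j) ≡ rowSum x i (n ∸ j)
mirrored-pair≡rowSum x i {n} {j} j≤n =
  trans (cong (λ k → x i k + x i (n ∸ j)) (+-∸-comm 1 j≤n)) (+-comm (x i (n ∸ j + 1)) (x i (n ∸ j)))

module OddGrid (m₀ n₀ : ℕ) (1≤m₀ : 1 ≤ m₀) (1≤n₀ : 1 ≤ n₀) (x : ℕ → ℕ → ℕ) {S : ℕ}
         (balanced : IsBicentrallyBalanced (2 * m₀ + 1) (2 * n₀ + 1) x)
         (magic : IsFaceMagic (2 * m₀ + 1) (2 * n₀ + 1) x S) where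

  m n : ℕ
  m = 2 * m₀ + 1
  n = 2 * n₀ + 1

  a : ℕ → ℕ
  a = rowSum x 1

  2≤2*k+1 : ∀ {k} → 1 ≤ k → 2 ≤ 2 * k + 1
  2≤2*k+1 1≤k = ≤-trans (*-monoʳ-≤ 2 1≤k) (m≤m+n _ 1)

  S≡2mn+3 : S ≡ 2 * m * n + 3
  S≡2mn+3 = faceMagic-value-unique {x = x} magic (2≤2*k+1 1≤m₀) (2≤2*k+1 1≤n₀) (proj₂ (proj₁ balanced))

  module Column {j} (1≤j : 1 ≤ j) (j+1≤n : j + 1 ≤ n) =
    ConstantConsecutiveSums (λ i → rowSum x i j) (rowSum-consecutive {x = x} magic 1≤j j+1≤n)

  first-row-mirror : ∀ {j} → 1 ≤ j → j + 1 ≤ n → a j + a (n ∸ j) ≡ S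
  first-row-mirror {j} 1≤j j+1≤n = begin
      a j + a (n ∸ j)
        ≡⟨ cong (a j +_) (Column.f[odd]≡f[1] 1≤n∸j n∸j+1≤n m₀ ≤-refl) ⟨
      a j + rowSum x m (n ∸ j)
        ≡⟨ solve 4 (λ p q u v → (p :+ q) :+ (u :+ v) := (p :+ v) :+ (q :+ u)) refl
             (x 1 j) (x 1 (j + 1)) (x m (n ∸ j)) (x m (n ∸ j + 1)) ⟩
      (x 1 j + x m (n ∸ j + 1)) + (x 1 (j + 1) + x m (n ∸ j))
        ≡⟨ cong₂ (λ k l → (x 1 j + x m k) + (x 1 (j + 1) + x m l))
             (+-∸-comm 1 j≤n) (cong₂ _∸_ (+-comm n 1) (+-comm j 1)) ⟨
      (x 1 j + x m (n + 1 ∸ j)) + (x 1 (j + 1) + x m (n + 1 ∸ (j + 1)))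
        ≡⟨ balanceValue-pair-sum m n 1 j (balance j 1≤j j≤n) (balance (j + 1) (m≤n+m 1 j) j+1≤n) ⟩
      (m * n + 3) / 2 + (3 * m * n + 3) / 2
        ≡⟨ balanceValues-sum m₀ n₀ ⟩
      2 * m * n + 3
        ≡⟨ S≡2mn+3 ⟨
      S ∎
    where
      open ≡-Reasoning
      j≤n : j ≤ n
      j≤n = ≤-trans (m≤m+n j 1) j+1≤n
      1≤n∸j : 1 ≤ n ∸ j
      1≤n∸j = proj₁ (mirror-column 1≤j j+1≤n)
      n∸j+1≤n : n ∸ j + 1 ≤ n
      n∸j+1≤n = proj₂ (mirror-column 1≤j j+1≤n)
      balance : ∀ k → 1 ≤ k → k ≤ n → BalanceValue m n 1 k (x 1 k + x m (n + 1 ∸ k))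
      balance k 1≤k k≤n = subst (λ r → BalanceValue m n 1 k (x 1 k + x r (n + 1 ∸ k)))
        (m+n∸n≡m m 1) (proj₂ balanced 1 k ((≤-refl , m≤n+m 1 (2 * m₀)) , (1≤k , k≤n)))

  LikeFirstRow : ℕ → Set
  LikeFirstRow i = ∀ {j} → 1 ≤ j → j + 1 ≤ n → rowSum x i j ≡ a j

  ComplementsFirstRow : ℕ → Set
  ComplementsFirstRow i = ∀ {j} → 1 ≤ j → j + 1 ≤ n → rowSum x i j + a j ≡ S

  odd-likeFirstRow : ∀ k → 2 * k + 1 ≤ m → LikeFirstRow (2 * k + 1)
  odd-likeFirstRow k h 1≤j j+1≤n = Column.f[odd]≡f[1] 1≤j j+1≤n k h

  even-complementsFirstRow : ∀ k → 2 * k + 2 ≤ m → ComplementsFirstRow (2 * k + 2)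
  even-complementsFirstRow k h 1≤j j+1≤n = Column.f[even]+f[1]≡S 1≤j j+1≤n k h

  mirror-rowSum : ∀ {i} → 1 ≤ i → i ≤ m₀ → ∀ {j} → 1 ≤ j → j + 1 ≤ n →
    rowSum x (m + 1 ∸ i) j ≡ rowSum x i j
  mirror-rowSum {i} 1≤i i≤m₀ 1≤j j+1≤n = Column.f[mirror]≡f 1≤j j+1≤n refl i 1≤i i≤m₀

  mirror-likeFirstRow : ∀ {i} → 1 ≤ i → i ≤ m₀ → LikeFirstRow i → LikeFirstRow (m + 1 ∸ i)
  mirror-likeFirstRow 1≤i i≤m₀ like 1≤j j+1≤n =
    trans (mirror-rowSum 1≤i i≤m₀ 1≤j j+1≤n) (like 1≤j j+1≤n)

  mirror-complementsFirstRow : ∀ {i} → 1 ≤ i → i ≤ m₀ →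
    ComplementsFirstRow i → ComplementsFirstRow (m + 1 ∸ i)
  mirror-complementsFirstRow 1≤i i≤m₀ complements {j} 1≤j j+1≤n =
    trans (cong (_+ a j) (mirror-rowSum 1≤i i≤m₀ 1≤j j+1≤n)) (complements 1≤j j+1≤n)

  likeFirstRow-claims : ∀ {i} → LikeFirstRow i → ∀ {j} → 1 ≤ j → j + 1 ≤ n →
    (x i j + x i (j + 1) ≡ a j) × (x i (n + 1 ∸ j) + x i (n ∸ j) + a j ≡ S)
  likeFirstRow-claims {i} like {j} 1≤j j+1≤n = like 1≤j j+1≤n , (begin
      x i (n + 1 ∸ j) + x i (n ∸ j) + a j ≡⟨ cong (_+ a j) (mirrored-pair≡rowSum x i (≤-trans (m≤m+n j 1) j+1≤n)) ⟩
      rowSum x i (n ∸ j) + a j           ≡⟨ cong (_+ a j) (like 1≤n∸j n∸j+1≤n) ⟩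
      a (n ∸ j) + a j                    ≡⟨ +-comm (a (n ∸ j)) (a j) ⟩
      a j + a (n ∸ j)                    ≡⟨ first-row-mirror 1≤j j+1≤n ⟩
      S                                  ∎)
    where
      open ≡-Reasoning
      1≤n∸j : 1 ≤ n ∸ j
      1≤n∸j = proj₁ (mirror-column 1≤j j+1≤n)
      n∸j+1≤n : n ∸ j + 1 ≤ n
      n∸j+1≤n = proj₂ (mirror-column 1≤j j+1≤n)

  complementsFirstRow-claims : ∀ {i} → ComplementsFirstRow i → ∀ {j} → 1 ≤ j → j + 1 ≤ n →
    (x i j + x i (j + 1) + a j ≡ S) × (x i (n + 1 ∸ j) + x i (n ∸ j) ≡ a j)
  complementsFirstRow-claims {i} complements {j} 1≤j j+1≤n = complements 1≤j j+1≤n , (begin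
      x i (n + 1 ∸ j) + x i (n ∸ j) ≡⟨ mirrored-pair≡rowSum x i (≤-trans (m≤m+n j 1) j+1≤n) ⟩
      rowSum x i (n ∸ j)            ≡⟨ +-cancelʳ-≡ (a (n ∸ j)) _ _ (trans
                                         (complements 1≤n∸j n∸j+1≤n) (sym (first-row-mirror 1≤j j+1≤n))) ⟩
      a j                           ∎)
    where
      open ≡-Reasoning
      1≤n∸j : 1 ≤ n ∸ j
      1≤n∸j = proj₁ (mirror-column 1≤j j+1≤n)
      n∸j+1≤n : n ∸ j + 1 ≤ n
      n∸j+1≤n = proj₂ (mirror-column 1≤j j+1≤n)

  ≤m₀⇒≤m : ∀ {i} → i ≤ m₀ → i ≤ m
  ≤m₀⇒≤m i≤m₀ = ≤-trans i≤m₀ (≤-trans (m≤n*m m₀ 2) (m≤m+n (2 * m₀) 1))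

  ≤n₀⇒+1≤n : ∀ {j} → j ≤ n₀ → j + 1 ≤ n
  ≤n₀⇒+1≤n j≤n₀ = +-monoˡ-≤ 1 (≤-trans j≤n₀ (m≤n*m n₀ 2))

lemma18 : (m₀ n₀ : ℕ) → 1 ≤ m₀ → 1 ≤ n₀ →
    let m = 2 * m₀ + 1
        n = 2 * n₀ + 1
    in (x : ℕ → ℕ → ℕ) (S : ℕ) →
       IsBicentrallyBalanced m n x → IsC4FaceMagicProjLabeling m n x S →
       let a = λ j → x 1 j + x 1 (j + 1)
       in (∀ k j → 2 * k + 1 ≤ m₀ → 1 ≤ j → j ≤ n₀ →
             let i = 2 * k + 1 in
             (x i j + x i (j + 1) ≡ a j)
             × (x i (n + 1 ∸ j) + x i (n ∸ j) + a j ≡ S)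
             × (x (m + 1 ∸ i) j + x (m + 1 ∸ i) (j + 1) ≡ a j)
             × (x (m + 1 ∸ i) (n + 1 ∸ j) + x (m + 1 ∸ i) (n ∸ j) + a j ≡ S))
          × (∀ k j → 2 * k + 2 ≤ m₀ → 1 ≤ j → j ≤ n₀ →
             let i = 2 * k + 2 in
             (x i j + x i (j + 1) + a j ≡ S)
             × (x i (n + 1 ∸ j) + x i (n ∸ j) ≡ a j)
             × (x (m + 1 ∸ i) j + x (m + 1 ∸ i) (j + 1) + a j ≡ S)
             × (x (m + 1 ∸ i) (n + 1 ∸ j) + x (m + 1 ∸ i) (n ∸ j) ≡ a j))
lemma18 m₀ n₀ 1≤m₀ 1≤n₀ x S balanced (_ , magic) =
    (λ k j i≤m₀ 1≤j j≤n₀ →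
      let like = odd-likeFirstRow k (≤m₀⇒≤m i≤m₀)
          (p , q) = likeFirstRow-claims like 1≤j (≤n₀⇒+1≤n j≤n₀)
          (p′ , q′) = likeFirstRow-claims (mirror-likeFirstRow (m≤n+m 1 (2 * k)) i≤m₀ like)
                                          1≤j (≤n₀⇒+1≤n j≤n₀)
      in p , q , p′ , q′) ,
    (λ k j i≤m₀ 1≤j j≤n₀ →
      let complements = even-complementsFirstRow k (≤m₀⇒≤m i≤m₀)
          (p , q) = complementsFirstRow-claims complements 1≤j (≤n₀⇒+1≤n j≤n₀)
          (p′ , q′) = complementsFirstRow-claims
                        (mirror-complementsFirstRow (≤-trans (s≤s z≤n) (m≤n+m 2 (2 * k))) i≤m₀ complements)
                        1≤j (≤n₀⇒+1≤n j≤n₀)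
      in p , q , p′ , q′)
  where open OddGrid m₀ n₀ 1≤m₀ 1≤n₀ x balanced magic
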